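{- Let $n\ge 6$ be an even integer with $n/2$ odd. Then there is a transitive permutation group $G$ of degree $n$ whose derangement graph $\Gamma_G$ is a complete multipartite graph with $n/2$ parts.
   Context: The derangement graph $\Gamma_G$ has vertex set $G$, with $g,h$ adjacent iff $gh^{ -1}$ is a derangement (an element with no fixed point). A complete multipartite graph with $k$ parts is a graph whose vertex set is partitioned into $k$ independent sets with every two vertices in different parts adjacent. -}

module Defs where

open import Level using (Level; suc; _⊔_)
open import Data.Nat using (ℕ)
open import Data.Fin using (Fin)
open import Data.Fin.Permutation using (Permutation′; _⟨$⟩ʳ_; _≈_; id; flip; _∘ₚ_)
open import Data.Product using (Σ; ∃; _×_; _,_)
open import Function.Bundles using (_⇔_)
open import Relation.Binary.PropositionalEquality using (_≡_; _≢_)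
open import Relation.Nullary using (¬_)

record PermGroup (n : ℕ) : Set₁ where
  field
    Mem      : Permutation′ n → Set
    resp     : ∀ {g h} → g ≈ h → Mem g → Mem h
    id-mem   : Mem id
    comp-mem : ∀ {g h} → Mem g → Mem h → Mem (g ∘ₚ h)
    inv-mem  : ∀ {g} → Mem g → Mem (flip g)

open PermGroup public

Elem : ∀ {n} → PermGroup n → Set
Elem {n} G = Σ (Permutation′ n) (Mem G)

Transitive : ∀ {n} → PermGroup n → Set
Transitive {n} G = ∀ (i j : Fin n) → ∃ λ (x : Elem G) → (Data.Product.proj₁ x ⟨$⟩ʳ i) ≡ j

Derangement : ∀ {n} → Permutation′ n → Set
Derangement {n} g = ∀ (i : Fin n) → g ⟨$⟩ʳ i ≢ i

-- g ~ h in Γ_G  iff  g h⁻¹ is a derangement.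
Adjacent : ∀ {n} → Permutation′ n → Permutation′ n → Set
Adjacent g h = Derangement (flip h ∘ₚ g)

CompleteMultipartite : ∀ {n} → PermGroup n → ℕ → Set
CompleteMultipartite {n} G k =
  Σ (Elem G → Fin k) λ part →
    (∀ (p : Fin k) → ∃ λ (x : Elem G) → part x ≡ p)
    × (∀ (x y : Elem G) →
         Adjacent (Data.Product.proj₁ x) (Data.Product.proj₁ y) ⇔ (part x ≢ part y))

-- Write m = n / 2 (odd) and let C₂ ≀ Cₘ act on Fin m × Bool by
-- (w , t) · (i , b) = (i + t , b xor w i).  Take G to be its index-2 subgroup of
-- pairs with w of even weight, i.e. w = δ v with δ v i = v i xor v (i + 1).
-- If t ≢ 0 (mod m) the element moves every point; if t ≡ 0 it fixes (i , b)
-- whenever w i = false, and such an i exists because the all-true pattern has odd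
-- weight m.  Hence g h⁻¹ is a derangement iff the shifts of g and h differ mod m,
-- so the m cosets of the normal subgroup {t ≡ 0} are the parts of Γ_G.
module Submission where

open import Defs
open import Data.Nat using (ℕ; _≤_; _/_)
open import Data.Nat.Divisibility using (_∣_)
open import Data.Product using (∃; _×_)
open import Relation.Nullary using (¬_)

open import Algebra.Bundles using (CommutativeRing)
open import Data.Bool using (Bool; true; false; not; _xor_)
open import Data.Bool.Properties
  using (xor-assoc; xor-same; xor-identityʳ; xor-∧-commutativeRing; not-involutive; not-¬; ¬-not)
import Data.Bool.Properties as Bool
open import Data.Empty using (⊥-elim)
open import Data.Fin using (Fin; zero; toℕ; fromℕ<)
open import Data.Fin.Permutation
  using (Permutation′; _⟨$⟩ʳ_; _⟨$⟩ˡ_; _≈_; flip; _∘ₚ_; permutation; inverseˡ)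
open import Data.Fin.Properties using (toℕ-fromℕ<; toℕ-injective; toℕ<n; ¬∀⟶∃¬; *↔×; 2↔Bool)
open import Data.Nat using (suc; pred; _+_; _*_; _∸_; _%_; _<_; NonZero; s≤s; z≤n; z<s)
open import Data.Nat.DivMod
  using (m%n<n; m%n%n≡m%n; %-distribˡ-+; [m+n]%n≡m%n; [m+kn]%n≡m%n; m<n⇒m%n≡m; m*n/n≡m)
open import Data.Nat.Divisibility using (divides; ∣-refl; ∣m∣n⇒∣m+n)
open import Data.Nat.Properties
  using (+-assoc; +-comm; *-suc; *-identityˡ; suc-pred; m+[n∸m]≡n; <⇒≤; <-trans; *-cancelʳ-<; ≤-trans)
open import Data.Product using (Σ; _,_; proj₁; proj₂)
open import Data.Product.Function.NonDependent.Propositional using (_×-↔_)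
open import Data.Vec.Functional using (updateAt)
open import Data.Vec.Functional.Properties using (updateAt-updates; updateAt-minimal)
open import Function.Base using (_∘_; const)
open import Function.Bundles using (_↔_; _⇔_; mk⇔; Inverse; Equivalence)
open import Function.Construct.Composition using (_⇔-∘_)
open import Function.Properties.Inverse using (↔-refl; ↔-sym; ↔-trans)
open import Relation.Binary.PropositionalEquality
open import Algebra.Properties.CommutativeSemigroup
  (CommutativeRing.+-commutativeSemigroup xor-∧-commutativeRing) using (interchange)

open ≡-Reasoning

xor-cancelʳ : ∀ x y → (x xor y) xor y ≡ x
xor-cancelʳ x y = begin
  (x xor y) xor y  ≡⟨ xor-assoc x y y ⟩
  x xor (y xor y)  ≡⟨ cong (x xor_) (xor-same y) ⟩
  x xor false      ≡⟨ xor-identityʳ x ⟩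
  x                ∎

xor-cancelˡ : ∀ x y → x xor (x xor y) ≡ y
xor-cancelˡ x y = trans (sym (xor-assoc x x y)) (cong (_xor y) (xor-same x))

xor≡true⇒≡not : ∀ x y → x xor y ≡ true → y ≡ not x
xor≡true⇒≡not false true  _ = refl
xor≡true⇒≡not true  false _ = refl

alternating-period-even : (f : ℕ → Bool) → (∀ s → f (suc s) ≡ not (f s)) →
                          ∀ m → f m ≡ f 0 → 2 ∣ m
alternating-period-even f alt 0 _ = divides 0 refl
alternating-period-even f alt 1 f1≡f0 = ⊥-elim (not-¬ refl (trans (sym f1≡f0) (alt 0)))
alternating-period-even f alt (suc (suc m)) fm+2≡f0 =
  ∣m∣n⇒∣m+n ∣-refl (alternating-period-even f alt m (trans (sym period-2) fm+2≡f0))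
  where
  period-2 : f (suc (suc m)) ≡ f m
  period-2 = trans (alt (suc m)) (trans (cong not (alt m)) (not-involutive (f m)))

[m%d+n]%d≡[m+n]%d : ∀ m n d .{{_ : NonZero d}} → (m % d + n) % d ≡ (m + n) % d
[m%d+n]%d≡[m+n]%d m n d = begin
  (m % d + n) % d          ≡⟨ %-distribˡ-+ (m % d) n d ⟩
  (m % d % d + n % d) % d  ≡⟨ cong (λ k → (k + n % d) % d) (m%n%n≡m%n m d) ⟩
  (m % d + n % d) % d      ≡⟨ %-distribˡ-+ m n d ⟨
  (m + n) % d              ∎

-- Codes need not form a group: only their action has to respect ε, _·_ and _⁻¹.
record Action (X : Set) : Set₁ where
  infixl 7 _·_
  infix  8 _⁻¹
  field
    Code    : Set
    act     : Code → X → X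
    ε       : Code
    _·_     : Code → Code → Code
    _⁻¹     : Code → Code
    act-ε   : ∀ x → act ε x ≡ x
    act-·   : ∀ c d x → act (c · d) x ≡ act d (act c x)
    act-⁻¹ˡ : ∀ c x → act (c ⁻¹) (act c x) ≡ x
    act-⁻¹ʳ : ∀ c x → act c (act (c ⁻¹) x) ≡ x

  HasFixedPoint : Code → Set
  HasFixedPoint c = ∃ λ x → act c x ≡ x

  IsTransitive : Set
  IsTransitive = ∀ x y → ∃ λ c → act c x ≡ y

module _ {X Y : Set} (e : X ↔ Y) (A : Action X) where
  open Action A
  open Inverse e using (to; from; strictlyInverseˡ; strictlyInverseʳ)

  conj : Code → Y → Y
  conj c = to ∘ act c ∘ from

  conj-∘ : ∀ c d y → conj d (conj c y) ≡ to (act d (act c (from y)))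
  conj-∘ c d y = cong (to ∘ act d) (strictlyInverseʳ (act c (from y)))

  transport : Action Y
  transport = record
    { Code    = Code
    ; act     = conj
    ; ε       = ε
    ; _·_     = _·_
    ; _⁻¹     = _⁻¹
    ; act-ε   = λ y → trans (cong to (act-ε (from y))) (strictlyInverseˡ y)
    ; act-·   = λ c d y → trans (cong to (act-· c d (from y))) (sym (conj-∘ c d y))
    ; act-⁻¹ˡ = λ c y → trans (conj-∘ c (c ⁻¹) y)
                          (trans (cong to (act-⁻¹ˡ c (from y))) (strictlyInverseˡ y))
    ; act-⁻¹ʳ = λ c y → trans (conj-∘ (c ⁻¹) c y)
                          (trans (cong to (act-⁻¹ʳ c (from y))) (strictlyInverseˡ y))
    }

  transport-transitive : IsTransitive → Action.IsTransitive transport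
  transport-transitive trans-A y y′ =
    let c , c-moves = trans-A (from y) (from y′)
    in c , trans (cong to c-moves) (strictlyInverseˡ y′)

  transport-fixedPoint : ∀ c → Action.HasFixedPoint transport c ⇔ HasFixedPoint c
  transport-fixedPoint c = mk⇔
    (λ (y , fixed) → from y , trans (sym (strictlyInverseʳ _)) (cong from fixed))
    (λ (x , fixed) → to x , cong to (trans (cong (act c) (strictlyInverseʳ x)) fixed))

module _ {n : ℕ} (A : Action (Fin n)) where
  open Action A

  toPerm : Code → Permutation′ n
  toPerm c = permutation (act c) (act (c ⁻¹)) (act-⁻¹ʳ c) (act-⁻¹ˡ c)

  ≈-∘ₚ : ∀ {g h c d} → g ≈ toPerm c → h ≈ toPerm d → g ∘ₚ h ≈ toPerm (c · d)
  ≈-∘ₚ {g} {h} {c} {d} g≈c h≈d i =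
    trans (h≈d (g ⟨$⟩ʳ i)) (trans (cong (act d) (g≈c i)) (sym (act-· c d i)))

  ≈-flip : ∀ {g c} → g ≈ toPerm c → flip g ≈ toPerm (c ⁻¹)
  ≈-flip {g} {c} g≈c i = begin
    g ⟨$⟩ˡ i                         ≡⟨ cong (g ⟨$⟩ˡ_) (act-⁻¹ʳ c i) ⟨
    g ⟨$⟩ˡ act c (act (c ⁻¹) i)      ≡⟨ cong (g ⟨$⟩ˡ_) (g≈c (act (c ⁻¹) i)) ⟨
    g ⟨$⟩ˡ (g ⟨$⟩ʳ act (c ⁻¹) i)     ≡⟨ inverseˡ g ⟩
    act (c ⁻¹) i                     ∎

  image : PermGroup n
  image = record
    { Mem      = λ g → Σ Code λ c → g ≈ toPerm c
    ; resp     = λ g≈h (c , g≈c) → c , λ i → trans (sym (g≈h i)) (g≈c i)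
    ; id-mem   = ε , λ i → sym (act-ε i)
    ; comp-mem = λ {g} {h} (c , g≈c) (d , h≈d) → c · d , ≈-∘ₚ {g} {h} g≈c h≈d
    ; inv-mem  = λ {g} (c , g≈c) → c ⁻¹ , ≈-flip {g} g≈c
    }

  element : Code → Elem image
  element c = toPerm c , c , λ _ → refl

  code : Elem image → Code
  code (_ , c , _) = c

  image-transitive : IsTransitive → Transitive image
  image-transitive trans-A i j =
    let c , c-moves = trans-A i j in element c , c-moves

  derangement⇔noFixedPoint : ∀ {g c} → g ≈ toPerm c → Derangement g ⇔ (¬ HasFixedPoint c)
  derangement⇔noFixedPoint g≈c = mk⇔
    (λ der (i , fixed) → der i (trans (g≈c i) fixed))
    (λ noFix i fixed → noFix (i , trans (sym (g≈c i)) fixed))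

  image-completeMultipartite : ∀ {k} (part : Code → Fin k) →
    (∀ p → ∃ λ c → part c ≡ p) →
    (∀ c d → HasFixedPoint (d ⁻¹ · c) ⇔ (part c ≡ part d)) →
    CompleteMultipartite image k
  image-completeMultipartite part part-onto criterion =
    part ∘ code , onto , adjacent⇔
    where
    onto : ∀ p → ∃ λ (x : Elem image) → part (code x) ≡ p
    onto p = let c , c-in-p = part-onto p in element c , c-in-p

    adjacent⇔ : ∀ x y → Adjacent (proj₁ x) (proj₁ y) ⇔ (part (code x) ≢ part (code y))
    adjacent⇔ (g , c , g≈c) (h , d , h≈d) = mk⇔
      (λ adj same → Equivalence.to noFix adj (Equivalence.from (criterion c d) same))
      (λ diff → Equivalence.from noFix (diff ∘ Equivalence.to (criterion c d)))
      where
      noFix : Adjacent g h ⇔ (¬ HasFixedPoint (d ⁻¹ · c))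
      noFix = derangement⇔noFixedPoint {flip h ∘ₚ g} (≈-∘ₚ {flip h} {g} (≈-flip {h} h≈d) g≈c)

module Rotation (m : ℕ) .{{_ : NonZero m}} where

  rot : ℕ → Fin m → Fin m
  rot t i = fromℕ< (m%n<n (toℕ i + t) m)

  toℕ-rot : ∀ t i → toℕ (rot t i) ≡ (toℕ i + t) % m
  toℕ-rot t i = toℕ-fromℕ< (m%n<n (toℕ i + t) m)

  rot-+ : ∀ s t i → rot (s + t) i ≡ rot t (rot s i)
  rot-+ s t i = toℕ-injective (begin
    toℕ (rot (s + t) i)        ≡⟨ toℕ-rot (s + t) i ⟩
    (toℕ i + (s + t)) % m      ≡⟨ cong (_% m) (+-assoc (toℕ i) s t) ⟨
    (toℕ i + s + t) % m        ≡⟨ [m%d+n]%d≡[m+n]%d (toℕ i + s) t m ⟨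
    ((toℕ i + s) % m + t) % m  ≡⟨ cong (λ k → (k + t) % m) (toℕ-rot s i) ⟨
    (toℕ (rot s i) + t) % m    ≡⟨ toℕ-rot t (rot s i) ⟨
    toℕ (rot t (rot s i))      ∎)

  rot-comm : ∀ s t i → rot s (rot t i) ≡ rot t (rot s i)
  rot-comm s t i =
    trans (sym (rot-+ t s i)) (trans (cong (λ k → rot k i) (+-comm t s)) (rot-+ s t i))

  rot-*m : ∀ k i → rot (k * m) i ≡ i
  rot-*m k i = toℕ-injective (begin
    toℕ (rot (k * m) i)    ≡⟨ toℕ-rot (k * m) i ⟩
    (toℕ i + k * m) % m    ≡⟨ [m+kn]%n≡m%n (toℕ i) k m ⟩
    toℕ i % m              ≡⟨ m<n⇒m%n≡m (toℕ<n i) ⟩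
    toℕ i                  ∎)

  rot-m : ∀ i → rot m i ≡ i
  rot-m i = trans (cong (λ k → rot k i) (sym (*-identityˡ m))) (rot-*m 1 i)

  rot-inverseʳ : ∀ t i → rot t (rot (t * pred m) i) ≡ i
  rot-inverseʳ t i = begin
    rot t (rot (t * pred m) i)  ≡⟨ rot-+ (t * pred m) t i ⟨
    rot (t * pred m + t) i      ≡⟨ cong (λ k → rot k i) shifts ⟩
    rot (t * m) i               ≡⟨ rot-*m t i ⟩
    i                           ∎
    where
    shifts : t * pred m + t ≡ t * m
    shifts = trans (+-comm (t * pred m) t)
               (trans (sym (*-suc t (pred m))) (cong (t *_) (suc-pred m)))

  rot-inverseˡ : ∀ t i → rot (t * pred m) (rot t i) ≡ i
  rot-inverseˡ t i = trans (rot-comm (t * pred m) t i) (rot-inverseʳ t i)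

  rot-reach : ∀ i j → ∃ λ t → rot t i ≡ j
  rot-reach i j = m ∸ toℕ i + toℕ j , toℕ-injective (begin
    toℕ (rot (m ∸ toℕ i + toℕ j) i)      ≡⟨ toℕ-rot (m ∸ toℕ i + toℕ j) i ⟩
    (toℕ i + (m ∸ toℕ i + toℕ j)) % m    ≡⟨ cong (_% m) (+-assoc (toℕ i) (m ∸ toℕ i) (toℕ j)) ⟨
    (toℕ i + (m ∸ toℕ i) + toℕ j) % m    ≡⟨ cong (λ k → (k + toℕ j) % m) (m+[n∸m]≡n (<⇒≤ (toℕ<n i))) ⟩
    (m + toℕ j) % m                      ≡⟨ cong (_% m) (+-comm m (toℕ j)) ⟩
    (toℕ j + m) % m                      ≡⟨ [m+n]%n≡m%n (toℕ j) m ⟩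
    toℕ j % m                            ≡⟨ m<n⇒m%n≡m (toℕ<n j) ⟩
    toℕ j                                ∎)

  rot-fixes-all : ∀ s i → rot s i ≡ i → ∀ j → rot s j ≡ j
  rot-fixes-all s i fixed j = begin
    rot s j              ≡⟨ cong (rot s) i↦j ⟨
    rot s (rot t i)      ≡⟨ rot-comm s t i ⟩
    rot t (rot s i)      ≡⟨ cong (rot t) fixed ⟩
    rot t i              ≡⟨ i↦j ⟩
    j                    ∎
    where
    t : ℕ
    t = proj₁ (rot-reach i j)
    i↦j : rot t i ≡ j
    i↦j = proj₂ (rot-reach i j)

  rot-1-moves : 1 < m → ∀ i → rot 1 i ≢ i
  rot-1-moves 1<m i fixed = 1≢0 (begin
    1                     ≡⟨ m<n⇒m%n≡m 1<m ⟨
    (0 + 1) % m           ≡⟨ cong (λ k → (k + 1) % m) (toℕ-fromℕ< 0<m) ⟨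
    (toℕ origin + 1) % m  ≡⟨ toℕ-rot 1 origin ⟨
    toℕ (rot 1 origin)    ≡⟨ cong toℕ (rot-fixes-all 1 i fixed origin) ⟩
    toℕ origin            ≡⟨ toℕ-fromℕ< 0<m ⟩
    0                     ∎)
    where
    0<m : 0 < m
    0<m = <-trans z<s 1<m
    origin : Fin m
    origin = fromℕ< 0<m
    1≢0 : 1 ≢ 0
    1≢0 ()

  rot-[-s+t]-fixes⇔ : ∀ s t i → rot (s * pred m + t) i ≡ i ⇔ rot t i ≡ rot s i
  rot-[-s+t]-fixes⇔ s t i = mk⇔
    (λ fixed → begin
      rot t i                          ≡⟨ rot-inverseʳ s (rot t i) ⟨
      rot s (rot (s * pred m) (rot t i)) ≡⟨ cong (rot s) (rot-comm (s * pred m) t i) ⟩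
      rot s (rot t (rot (s * pred m) i)) ≡⟨ cong (rot s) (rot-+ (s * pred m) t i) ⟨
      rot s (rot (s * pred m + t) i)   ≡⟨ cong (rot s) fixed ⟩
      rot s i                          ∎)
    (λ same → begin
      rot (s * pred m + t) i           ≡⟨ rot-+ (s * pred m) t i ⟩
      rot t (rot (s * pred m) i)       ≡⟨ rot-comm t (s * pred m) i ⟩
      rot (s * pred m) (rot t i)       ≡⟨ cong (rot (s * pred m)) same ⟩
      rot (s * pred m) (rot s i)       ≡⟨ rot-inverseˡ s i ⟩
      i                                ∎)

open Action using (HasFixedPoint; IsTransitive)

module EvenFlips (m-1 : ℕ) where

  m : ℕ
  m = suc m-1

  open Rotation m

  δ : (Fin m → Bool) → Fin m → Bool
  δ v i = v i xor v (rot 1 i)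

  δ-xor : ∀ v w i → δ (λ j → v j xor w j) i ≡ δ v i xor δ w i
  δ-xor v w i = interchange (v i) (w i) (v (rot 1 i)) (w (rot 1 i))

  δ-∘-rot : ∀ v t i → δ (v ∘ rot t) i ≡ δ v (rot t i)
  δ-∘-rot v t i = cong (λ j → v (rot t i) xor v j) (rot-comm t 1 i)

  δ-updateAt : ∀ i x → rot 1 i ≢ i → δ (updateAt (const false) i (const x)) i ≡ x
  δ-updateAt i x moves = begin
    δ (updateAt (const false) i (const x)) i ≡⟨ cong₂ _xor_ (updateAt-updates i (const false))
                                                   (updateAt-minimal (rot 1 i) i (const false) moves) ⟩
    x xor false                              ≡⟨ xor-identityʳ x ⟩
    x                                        ∎

  -- Walking around the cycle, an all-true δ v would flip v at each of the m steps.
  δ-all-true⇒even : ∀ v → (∀ i → δ v i ≡ true) → 2 ∣ m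
  δ-all-true⇒even v all-true = alternating-period-even walk step m (cong v (rot-m zero))
    where
    walk : ℕ → Bool
    walk s = v (rot s zero)
    step : ∀ s → walk (suc s) ≡ not (walk s)
    step s = trans (cong v (trans (rot-+ 1 s zero) (rot-comm s 1 zero)))
                   (xor≡true⇒≡not _ _ (all-true (rot s zero)))

  δ-somewhere-false : ¬ 2 ∣ m → ∀ v → ∃ λ i → δ v i ≡ false
  δ-somewhere-false odd v =
    let i , ≢true = ¬∀⟶∃¬ m (λ i → δ v i ≡ true) (λ i → δ v i Bool.≟ true) (odd ∘ δ-all-true⇒even v)
    in i , ¬-not ≢true

  Point : Set
  Point = Fin m × Bool

  Flip : Set
  Flip = (Fin m → Bool) × ℕ

  act : Flip → Point → Point
  act (v , t) (i , b) = rot t i , b xor δ v i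

  infixl 7 _·_
  infix  8 _⁻¹

  _·_ : Flip → Flip → Flip
  (v , s) · (w , t) = (λ i → v i xor w (rot s i)) , s + t

  _⁻¹ : Flip → Flip
  (v , t) ⁻¹ = v ∘ rot (t * pred m) , t * pred m

  act-· : ∀ c d x → act (c · d) x ≡ act d (act c x)
  act-· (v , s) (w , t) (i , b) = cong₂ _,_ (rot-+ s t i) (begin
    b xor δ (λ j → v j xor w (rot s j)) i   ≡⟨ cong (b xor_) (δ-xor v (w ∘ rot s) i) ⟩
    b xor (δ v i xor δ (w ∘ rot s) i)       ≡⟨ cong (λ k → b xor (δ v i xor k)) (δ-∘-rot w s i) ⟩
    b xor (δ v i xor δ w (rot s i))         ≡⟨ xor-assoc b (δ v i) (δ w (rot s i)) ⟨
    (b xor δ v i) xor δ w (rot s i)         ∎)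

  act-⁻¹ˡ : ∀ c x → act (c ⁻¹) (act c x) ≡ x
  act-⁻¹ˡ (v , t) (i , b) = cong₂ _,_ (rot-inverseˡ t i) (begin
    (b xor δ v i) xor δ (v ∘ rot (t * pred m)) (rot t i)
      ≡⟨ cong ((b xor δ v i) xor_) (δ-∘-rot v (t * pred m) (rot t i)) ⟩
    (b xor δ v i) xor δ v (rot (t * pred m) (rot t i))
      ≡⟨ cong (λ j → (b xor δ v i) xor δ v j) (rot-inverseˡ t i) ⟩
    (b xor δ v i) xor δ v i
      ≡⟨ xor-cancelʳ b (δ v i) ⟩
    b ∎)

  act-⁻¹ʳ : ∀ c x → act c (act (c ⁻¹) x) ≡ x
  act-⁻¹ʳ (v , t) (i , b) = cong₂ _,_ (rot-inverseʳ t i) (begin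
    (b xor δ (v ∘ rot (t * pred m)) i) xor δ v (rot (t * pred m) i)
      ≡⟨ cong (λ k → (b xor k) xor δ v (rot (t * pred m) i)) (δ-∘-rot v (t * pred m) i) ⟩
    (b xor δ v (rot (t * pred m) i)) xor δ v (rot (t * pred m) i)
      ≡⟨ xor-cancelʳ b (δ v (rot (t * pred m) i)) ⟩
    b ∎)

  evenFlips : Action Point
  evenFlips = record
    { Code    = Flip
    ; act     = act
    ; ε       = const false , 0
    ; _·_     = _·_
    ; _⁻¹     = _⁻¹
    ; act-ε   = λ (i , b) → cong₂ _,_ (rot-*m 0 i) (xor-identityʳ b)
    ; act-·   = act-·
    ; act-⁻¹ˡ = act-⁻¹ˡ
    ; act-⁻¹ʳ = act-⁻¹ʳ
    }

  evenFlips-transitive : 1 < m → IsTransitive evenFlips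
  evenFlips-transitive 1<m (i , b) (j , c) =
    (updateAt (const false) i (const (b xor c)) , t) ,
    cong₂ _,_ i↦j (trans (cong (b xor_) (δ-updateAt i (b xor c) (rot-1-moves 1<m i))) (xor-cancelˡ b c))
    where
    t : ℕ
    t = proj₁ (rot-reach i j)
    i↦j : rot t i ≡ j
    i↦j = proj₂ (rot-reach i j)

  shift : Flip → Fin m
  shift (_ , t) = rot t zero

  shift-onto : ∀ p → ∃ λ c → shift c ≡ p
  shift-onto p = let t , 0↦p = rot-reach zero p in (const false , t) , 0↦p

  fixedPoint⇔shift≡zero : ¬ 2 ∣ m → ∀ c → HasFixedPoint evenFlips c ⇔ (shift c ≡ zero)
  fixedPoint⇔shift≡zero odd (v , t) = mk⇔
    (λ ((i , b) , fixed) → rot-fixes-all t i (cong proj₁ fixed) zero)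
    (λ 0-fixed → let i , δvi≡false = δ-somewhere-false odd v in
      (i , false) , cong₂ _,_ (rot-fixes-all t zero 0-fixed i) δvi≡false)

  evenFlips-criterion : ¬ 2 ∣ m → ∀ c d → HasFixedPoint evenFlips (d ⁻¹ · c) ⇔ (shift c ≡ shift d)
  evenFlips-criterion odd (v , s) (w , t) =
    rot-[-s+t]-fixes⇔ t s zero ⇔-∘ fixedPoint⇔shift≡zero odd ((w , t) ⁻¹ · (v , s))

points↔Fin : ∀ m → (Fin m × Bool) ↔ Fin (m * 2)
points↔Fin m = ↔-sym (↔-trans *↔× (↔-refl ×-↔ 2↔Bool))

∃-transitive-completeMultipartite : ∀ m → 1 < m → ¬ 2 ∣ m →
  ∃ λ (G : PermGroup (m * 2)) → Transitive G × CompleteMultipartite G m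
∃-transitive-completeMultipartite (suc m-1) 1<m odd =
  image G , image-transitive G (transport-transitive e evenFlips (evenFlips-transitive 1<m)) ,
  image-completeMultipartite G shift shift-onto λ c d →
    evenFlips-criterion odd c d ⇔-∘ transport-fixedPoint e evenFlips (d ⁻¹ · c)
  where
  open EvenFlips m-1
  e : Point ↔ Fin (m * 2)
  e = points↔Fin m
  G : Action (Fin (m * 2))
  G = transport e evenFlips

lemma5p3 : (n : ℕ) → 6 ≤ n → 2 ∣ n → ¬ (2 ∣ n / 2) →
    ∃ λ (G : PermGroup n) → Transitive G × CompleteMultipartite G (n / 2)
lemma5p3 .(q * 2) 6≤n (divides q refl) 2∤n/2 rewrite m*n/n≡m q 2 ⦃ _ ⦄ =
  ∃-transitive-completeMultipartite q 1<q 2∤n/2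
  where
  1<q : 1 < q
  1<q = *-cancelʳ-< 2 1 q (≤-trans (s≤s (s≤s (s≤s z≤n))) 6≤n)
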